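{- Let $k > 2$ be an integer and let $\varepsilon > 0$ be a real number. Then there exists $d_0 > 0$ such that for every integer $d \geq d_0$, every finite $d$-regular linear $k$-graph $H$ and every vertex $v \in V(H)$, $$\frac{1}{d+1} \leq \mathcal{P}_H(\overline{v}) < 1 - \frac{1 - \varepsilon}{d^{k-2}}.$$
   Context: A $k$-graph is a $k$-uniform hypergraph. It is linear if any two distinct edges share at most one vertex, and $d$-regular if every vertex lies in exactly $d$ edges. A matching is a set of pairwise vertex-disjoint edges; the empty set is a matching. For a finite $k$-graph $H$, let $M$ be a matching chosen uniformly at random from the set of all matchings of $H$. For $v \in V(H)$, $\mathcal{P}_H(\overline{v})$ denotes the probability that no edge of $M$ contains $v$. -}

module Defs where

open import Data.Nat as ℕ using (ℕ; zero; suc; _≤_)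
open import Data.Integer using (+_)
open import Data.Rational using (ℚ; 0ℚ; _/_)
open import Data.Fin using (Fin; _≟_)
open import Data.Fin.Properties using (all?)
open import Data.Fin.Subset using (Subset; Side; inside; outside; _∈_; _∉_; _∩_; ∣_∣)
open import Data.Fin.Subset.Properties using (_∈?_)
open import Data.Vec using ([]; _∷_)
open import Data.List using (List; []; _∷_; _++_; map; filter; length)
open import Data.List.Base using (allFin)
open import Data.Product using (_×_)
open import Data.Empty using (⊥)
open import Relation.Nullary using (Dec; ¬_; ¬?; no)
open import Relation.Nullary.Decidable using (_×-dec_; _→-dec_)
open import Relation.Binary.PropositionalEquality using (_≡_; _≢_)
open import Function.Definitions using (Injective)

record Hypergraph : Set where
  field
    n        : ℕ
    m        : ℕ
    edge     : Fin m → Subset n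
    distinct : Injective _≡_ _≡_ edge
open Hypergraph public

IsUniform : ℕ → Hypergraph → Set
IsUniform k H = ∀ e → ∣ edge H e ∣ ≡ k

IsLinear : Hypergraph → Set
IsLinear H = ∀ e f → e ≢ f → ∣ edge H e ∩ edge H f ∣ ≤ 1

degree : (H : Hypergraph) → Fin (n H) → ℕ
degree H v = length (filter (λ e → v ∈? edge H e) (allFin (m H)))

IsRegular : ℕ → Hypergraph → Set
IsRegular d H = ∀ v → degree H v ≡ d

allSubsets : (m : ℕ) → List (Subset m)
allSubsets zero    = [] ∷ []
allSubsets (suc m) = map (outside ∷_) (allSubsets m) ++ map (inside ∷_) (allSubsets m)

IsMatching : (H : Hypergraph) → Subset (m H) → Set
IsMatching H S = ∀ e f → e ∈ S → f ∈ S → e ≢ f →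
                 ∀ x → x ∈ edge H e → x ∈ edge H f → ⊥

isMatching? : (H : Hypergraph) → (S : Subset (m H)) → Dec (IsMatching H S)
isMatching? H S =
  all? λ e → all? λ f → (e ∈? S) →-dec ((f ∈? S) →-dec (¬? (e ≟ f) →-dec
  all? λ x → (x ∈? edge H e) →-dec ((x ∈? edge H f) →-dec no (λ ()))))

Avoids : (H : Hypergraph) → Fin (n H) → Subset (m H) → Set
Avoids H v S = ∀ e → e ∈ S → v ∉ edge H e

avoids? : (H : Hypergraph) (v : Fin (n H)) (S : Subset (m H)) → Dec (Avoids H v S)
avoids? H v S = all? λ e → (e ∈? S) →-dec ¬? (v ∈? edge H e)

matchings : (H : Hypergraph) → List (Subset (m H))
matchings H = filter (isMatching? H) (allSubsets (m H))

-- a / b as a rational (b = 0 branch is unreachable in our uses)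
_÷ℕ_ : ℕ → ℕ → ℚ
a ÷ℕ zero  = 0ℚ
a ÷ℕ suc b = (+ a) / suc b

probAvoid : (H : Hypergraph) → Fin (n H) → ℚ
probAvoid H v = length (filter (avoids? H v) (matchings H)) ÷ℕ length (matchings H)

-- Let A and C count the matchings that avoid and that cover v, so that P(v̄) = A/(A+C).
-- Deleting the edge at v maps a covering matching injectively to a pair (avoiding matching,
-- edge at v); hence C ≤ d·A and P(v̄) ≥ 1/(d+1).  Conversely, fix an edge e ∋ v.  Starting from
-- the matchings avoiding v, uncover the other k−1 vertices of e one at a time: a vertex w is
-- covered only by one of the ≤ d−1 edges through w that miss v, so each step loses a factor ≤ d.
-- A matching avoiding all of e extends by e, so A ≤ d^(k−1)·#(matchings containing e).  The d
-- edges at v are pairwise exclusive in a matching, so summing gives d·A ≤ d^(k−1)·C.  With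
-- D = d^(k−2) this is P(v̄) ≤ D/(D+1), and D/(D+1) < 1 − (1−ε)/D once D ≥ 1/ε, which holds
-- for d at least the denominator of ε.

module Submission where

open import Defs

module ListCounting where

  open import Data.Nat using (suc; _+_; _*_; _≤_; z≤n; s≤s)
  open import Data.Nat.Properties using (+-suc; m≤n⇒m≤1+n)
  open import Data.Fin using (Fin; combine)
  open import Data.Fin.Properties using (injective⇒≤; combine-injective)
  open import Data.List using (List; []; _∷_; filter; length; lookup)
  open import Data.List.Membership.Propositional using (_∈_)
  open import Data.List.Membership.Propositional.Properties using (∈-lookup)
  open import Data.List.Relation.Unary.Any using (here; there; index)
  open import Data.List.Relation.Unary.Any.Properties using (lookup-index)
  open import Data.List.Relation.Unary.All as All using ()
  open import Data.List.Relation.Unary.AllPairs using (_∷_)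
  open import Data.List.Relation.Unary.Unique.Propositional using (Unique)
  open import Data.Product using (_,_)
  open import Data.Empty using (⊥-elim)
  open import Function using (_∘_)
  open import Relation.Nullary using (yes; no; ¬?)
  open import Relation.Nullary.Decidable using (_×-dec_)
  open import Relation.Unary using (Pred; Decidable)
  open import Relation.Binary.PropositionalEquality

  module _ {a} {A : Set a} where

    length≡filter+filter-¬ : ∀ {q} {Q : Pred A q} (Q? : Decidable Q) xs →
      length xs ≡ length (filter Q? xs) + length (filter (λ x → ¬? (Q? x)) xs)
    length≡filter+filter-¬ Q? [] = refl
    length≡filter+filter-¬ Q? (x ∷ xs) with Q? x
    ... | yes _ = cong suc (length≡filter+filter-¬ Q? xs)
    ... | no _  = trans (cong suc (length≡filter+filter-¬ Q? xs)) (sym (+-suc _ _))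

    length-filter≡∧+∧¬ : ∀ {p q} {P : Pred A p} {Q : Pred A q} (P? : Decidable P) (Q? : Decidable Q) xs →
      length (filter P? xs) ≡
        length (filter (λ x → P? x ×-dec Q? x) xs) + length (filter (λ x → P? x ×-dec ¬? (Q? x)) xs)
    length-filter≡∧+∧¬ P? Q? [] = refl
    length-filter≡∧+∧¬ P? Q? (x ∷ xs) with P? x | Q? x
    ... | yes _ | yes _ = cong suc (length-filter≡∧+∧¬ P? Q? xs)
    ... | yes _ | no _  = trans (cong suc (length-filter≡∧+∧¬ P? Q? xs)) (sym (+-suc _ _))
    ... | no _  | _     = length-filter≡∧+∧¬ P? Q? xs

    length-filter-mono : ∀ {p q} {P : Pred A p} {Q : Pred A q} (P? : Decidable P) (Q? : Decidable Q) xs →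
      (∀ {x} → x ∈ xs → P x → Q x) → length (filter P? xs) ≤ length (filter Q? xs)
    length-filter-mono P? Q? [] P⇒Q = z≤n
    length-filter-mono P? Q? (x ∷ xs) P⇒Q with P? x | Q? x
    ... | yes _  | yes _  = s≤s (length-filter-mono P? Q? xs (P⇒Q ∘ there))
    ... | yes px | no ¬qx = ⊥-elim (¬qx (P⇒Q (here refl) px))
    ... | no _   | yes _  = m≤n⇒m≤1+n (length-filter-mono P? Q? xs (P⇒Q ∘ there))
    ... | no _   | no _   = length-filter-mono P? Q? xs (P⇒Q ∘ there)

    ∈⇒1≤length : ∀ {x : A} {xs} → x ∈ xs → 1 ≤ length xs
    ∈⇒1≤length (here _)  = s≤s z≤n
    ∈⇒1≤length (there _) = s≤s z≤n

    Unique⇒lookup-injective : ∀ {xs : List A} → Unique xs → ∀ i j → lookup xs i ≡ lookup xs j → i ≡ j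
    Unique⇒lookup-injective {_ ∷ _} _         Fin.zero    Fin.zero    _  = refl
    Unique⇒lookup-injective {_ ∷ _} (x∉ ∷ _)  Fin.zero    (Fin.suc j) eq = ⊥-elim (All.lookup x∉ (∈-lookup j) eq)
    Unique⇒lookup-injective {_ ∷ _} (x∉ ∷ _)  (Fin.suc i) Fin.zero    eq = ⊥-elim (All.lookup x∉ (∈-lookup i) (sym eq))
    Unique⇒lookup-injective {_ ∷ _} (_ ∷ xs!) (Fin.suc i) (Fin.suc j) eq =
      cong Fin.suc (Unique⇒lookup-injective xs! i j eq)

  injection⇒length≤length*length : ∀ {a b c} {A : Set a} {B : Set b} {C : Set c}
    {xs : List A} {ys : List B} {zs : List C} → Unique xs →
    (image : ∀ {x} → x ∈ xs → B) (label : ∀ {x} → x ∈ xs → C) →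
    (∀ {x} (x∈ : x ∈ xs) → image x∈ ∈ ys) → (∀ {x} (x∈ : x ∈ xs) → label x∈ ∈ zs) →
    (∀ {x x′} (x∈ : x ∈ xs) (x′∈ : x′ ∈ xs) →
      image x∈ ≡ image x′∈ → label x∈ ≡ label x′∈ → x ≡ x′) →
    length xs ≤ length zs * length ys
  injection⇒length≤length*length {xs = xs} {ys} {zs} xs! image label image∈ label∈ injective =
    injective⇒≤ {f = encode} encode-injective
    where
    encode : Fin (length xs) → Fin (length zs * length ys)
    encode i = combine (index (label∈ (∈-lookup i))) (index (image∈ (∈-lookup i)))
    index≡⇒≡ : ∀ {ℓ} {W : Set ℓ} {ws : List W} {w w′} (w∈ : w ∈ ws) (w′∈ : w′ ∈ ws) →
      index w∈ ≡ index w′∈ → w ≡ w′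
    index≡⇒≡ {ws = ws} w∈ w′∈ eq = trans (lookup-index w∈) (trans (cong (lookup ws) eq) (sym (lookup-index w′∈)))
    encode-injective : ∀ {i j} → encode i ≡ encode j → i ≡ j
    encode-injective {i} {j} eq with combine-injective _ _ _ _ eq
    ... | same-label , same-image = Unique⇒lookup-injective xs! i j (injective (∈-lookup i) (∈-lookup j)
          (index≡⇒≡ (image∈ (∈-lookup i)) (image∈ (∈-lookup j)) same-image)
          (index≡⇒≡ (label∈ (∈-lookup i)) (label∈ (∈-lookup j)) same-label))

module Subsets where

  open import Data.Nat using (ℕ; zero; suc)
  open import Data.Fin using (Fin; _≟_)
  open import Data.Fin.Subset using (Subset; Side; inside; outside; _∈_; _∉_; ∣_∣)
  open import Data.Fin.Subset.Properties using (_∈?_; drop-there)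
  open import Data.List using (_++_; map; filter; length; tabulate; allFin)
  open import Data.List.Membership.Propositional using () renaming (_∈_ to _∈ₗ_)
  open import Data.List.Membership.Propositional.Properties using (∈-map⁺; ∈-map⁻; ∈-++⁺ˡ; ∈-++⁺ʳ)
  open import Data.List.Relation.Unary.Any using (here)
  open import Data.List.Relation.Unary.All using ([])
  open import Data.List.Relation.Unary.AllPairs using ([]; _∷_)
  open import Data.List.Relation.Unary.Unique.Propositional using (Unique)
  import Data.List.Relation.Unary.Unique.Propositional.Properties as Unique
  open import Data.Product using (_×_; _,_)
  open import Data.Vec using ([]; _∷_; here; there; lookup; _[_]=_; _[_]≔_)
  open import Data.Vec.Properties
    using ( []=⇒lookup; lookup⇒[]=; []=-injective; lookup∘updateAt′; []≔-idempotent; []≔-lookup; []≔-updates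
          ; ∷-injectiveʳ)
  open import Data.Sum using (_⊎_; inj₁; inj₂)
  open import Function using (id; _∘_)
  open import Relation.Nullary using (yes; no; ¬_; contradiction)
  open import Relation.Unary using (Pred; Decidable)
  open import Relation.Binary.PropositionalEquality

  private
    variable
      k : ℕ
      x f : Fin k
      M : Subset k
      s t : Side

  ∉⇒[]=outside : x ∉ M → M [ x ]= outside
  ∉⇒[]=outside {x = x} {M} x∉M with lookup M x in eq
  ... | outside = lookup⇒[]= x M eq
  ... | inside  = contradiction (lookup⇒[]= x M eq) x∉M

  []=-[]≔ : x ≢ f → (M [ f ]≔ s) [ x ]= t → M [ x ]= t
  []=-[]≔ {x = x} {f} {M} x≢f x∈ = lookup⇒[]= x M (trans (sym (lookup∘updateAt′ x f x≢f M)) ([]=⇒lookup x∈))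

  []≔-[]≔-revert : M [ f ]= s → (M [ f ]≔ t) [ f ]≔ s ≡ M
  []≔-[]≔-revert {M = M} {f} M[f]=s =
    trans ([]≔-idempotent M f) (trans (cong (M [ f ]≔_) (sym ([]=⇒lookup M[f]=s))) ([]≔-lookup M f))

  f∉[]≔outside : f ∉ M [ f ]≔ outside
  f∉[]≔outside {f = f} {M} f∈ with () ← []=-injective ([]≔-updates M f) f∈

  ∈-[]≔outside⁻ : x ∈ M [ f ]≔ outside → x ∈ M
  ∈-[]≔outside⁻ {x = x} {f = f} x∈ with x ≟ f
  ... | yes refl = contradiction x∈ f∉[]≔outside
  ... | no x≢f   = []=-[]≔ x≢f x∈

  ∈-[]≔inside⁻ : x ∈ M [ f ]≔ inside → x ≡ f ⊎ x ∈ M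
  ∈-[]≔inside⁻ {x = x} {f = f} x∈ with x ≟ f
  ... | yes x≡f = inj₁ x≡f
  ... | no x≢f  = inj₂ ([]=-[]≔ x≢f x∈)

  length-filter-tabulate : ∀ {a q} {A : Set a} {Q : Pred A q} (Q? : Decidable Q) (f : Fin k → A) (p : Subset k) →
    (∀ {i} → Q (f i) → i ∈ p) → (∀ {i} → i ∈ p → Q (f i)) → length (filter Q? (tabulate f)) ≡ ∣ p ∣
  length-filter-tabulate Q? f [] _ _ = refl
  length-filter-tabulate Q? f (s ∷ p) Q⇒∈ ∈⇒Q with Q? (f Fin.zero) | s
  ... | yes _   | inside  = cong suc (length-filter-tabulate Q? (f ∘ Fin.suc) p (drop-there ∘ Q⇒∈) (∈⇒Q ∘ there))
  ... | no ¬Q₀  | inside  = contradiction (∈⇒Q here) ¬Q₀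
  ... | yes Q₀  | outside with () ← Q⇒∈ Q₀
  ... | no _    | outside = length-filter-tabulate Q? (f ∘ Fin.suc) p (drop-there ∘ Q⇒∈) (∈⇒Q ∘ there)

  length-members : (p : Subset k) → length (filter (_∈? p) (allFin k)) ≡ ∣ p ∣
  length-members p = length-filter-tabulate (_∈? p) id p id id

  allSubsets-complete : ∀ k (S : Subset k) → S ∈ₗ allSubsets k
  allSubsets-complete zero    []            = here refl
  allSubsets-complete (suc k) (outside ∷ S) = ∈-++⁺ˡ (∈-map⁺ (outside ∷_) (allSubsets-complete k S))
  allSubsets-complete (suc k) (inside ∷ S)  = ∈-++⁺ʳ _ (∈-map⁺ (inside ∷_) (allSubsets-complete k S))

  allSubsets-unique : ∀ k → Unique (allSubsets k)
  allSubsets-unique zero    = [] ∷ []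
  allSubsets-unique (suc k) =
    Unique.++⁺ (Unique.map⁺ ∷-injectiveʳ (allSubsets-unique k)) (Unique.map⁺ ∷-injectiveʳ (allSubsets-unique k)) disjoint
    where
    disjoint : ∀ {S} → ¬ (S ∈ₗ map (outside ∷_) (allSubsets k) × S ∈ₗ map (inside ∷_) (allSubsets k))
    disjoint (S∈ , S∈′) with ∈-map⁻ (outside ∷_) S∈ | ∈-map⁻ (inside ∷_) S∈′
    ... | _ , _ , refl | _ , _ , ()

module MatchingCounts (H : Hypergraph) where

  open ListCounting
  open Subsets
  open import Data.Nat using (ℕ; suc; _+_; _*_; _^_; _≤_; _<_; z≤n; >-nonZero)
  open import Data.Nat.Properties
    using ( ≤-trans; ≤-reflexive; ≤-pred; +-identityʳ; +-mono-≤; +-monoˡ-≤; *-mono-≤; *-monoˡ-≤; *-monoʳ-≤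
          ; ^-monoʳ-≤; *-assoc; *-comm; *-distribˡ-+; *-cancelˡ-≤; module ≤-Reasoning)
  open import Data.List using (List; []; _∷_; _++_; filter; length; allFin)
  open import Data.List.Properties using (filter-≐; filter-notAll)
  open import Data.List.Membership.Propositional using (find) renaming (_∈_ to _∈ₗ_)
  open import Data.List.Membership.Propositional.Properties
    using (∈-++⁺ˡ; ∈-++⁺ʳ; ∈-filter⁺; ∈-filter⁻; ∈-allFin)
  open import Data.List.Relation.Unary.Any as Any using (Any; here; there)
  open import Data.List.Relation.Unary.All as All using (All; []; _∷_)
  open import Data.List.Relation.Unary.AllPairs using ([]; _∷_)
  open import Data.List.Relation.Unary.Unique.Propositional using (Unique)
  import Data.List.Relation.Unary.Unique.Propositional.Properties as Unique
  open import Data.Fin using (Fin; _≟_)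
  open import Data.Fin.Properties using (any?)
  open import Data.Fin.Subset using (Subset; inside; outside; _∈_; _∉_; ⊥; ∣_∣)
  open import Data.Fin.Subset.Properties using (_∈?_; ∉⊥)
  open import Data.Vec using (_[_]≔_)
  open import Data.Vec.Properties using ([]≔-updates)
  open import Data.Product using (∃; _×_; _,_; proj₁; proj₂)
  open import Data.Sum using (inj₁; inj₂)
  open import Function using (_∘_)
  open import Relation.Nullary using (yes; no; ¬_; ¬?; contradiction)
  open import Relation.Nullary.Decidable using (_×-dec_)
  open import Relation.Unary using (Pred; Decidable)
  open import Relation.Binary.PropositionalEquality

  Vertex Edge : Set
  Vertex = Fin (n H)
  Edge   = Fin (m H)

  Edges : Set
  Edges = Subset (m H)

  matchings-unique : Unique (matchings H)
  matchings-unique = Unique.filter⁺ (isMatching? H) (allSubsets-unique (m H))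

  ∈-matchings⁺ : ∀ {M} → IsMatching H M → M ∈ₗ matchings H
  ∈-matchings⁺ {M} = ∈-filter⁺ (isMatching? H) (allSubsets-complete _ M)

  ∈-matchings⁻ : ∀ {M} → M ∈ₗ matchings H → IsMatching H M
  ∈-matchings⁻ = proj₂ ∘ ∈-filter⁻ (isMatching? H) {xs = allSubsets (m H)}

  ∅-isMatching : IsMatching H ⊥
  ∅-isMatching e _ e∈ = contradiction e∈ ∉⊥

  []≔outside-isMatching : ∀ {M} f → IsMatching H M → IsMatching H (M [ f ]≔ outside)
  []≔outside-isMatching f M! e g e∈ g∈ = M! e g (∈-[]≔outside⁻ e∈) (∈-[]≔outside⁻ g∈)

  []≔inside-isMatching : ∀ {M} e → IsMatching H M → (∀ x → x ∈ edge H e → Avoids H x M) →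
    IsMatching H (M [ e ]≔ inside)
  []≔inside-isMatching e M! e-free f g f∈ g∈ f≢g x x∈f x∈g with ∈-[]≔inside⁻ f∈ | ∈-[]≔inside⁻ g∈
  ... | inj₁ refl | inj₁ refl = f≢g refl
  ... | inj₁ refl | inj₂ g∈M  = e-free x x∈f g g∈M x∈g
  ... | inj₂ f∈M  | inj₁ refl = e-free x x∈g f f∈M x∈f
  ... | inj₂ f∈M  | inj₂ g∈M  = M! f g f∈M g∈M f≢g x x∈f x∈g

  ¬Avoids⇒covering-edge : ∀ {u M} → ¬ Avoids H u M → ∃ λ f → f ∈ M × u ∈ edge H f
  ¬Avoids⇒covering-edge {u} {M} ¬avoids with any? (λ f → (f ∈? M) ×-dec (u ∈? edge H f))
  ... | yes covering = covering
  ... | no ¬covering = contradiction (λ f f∈M u∈f → ¬covering (f , f∈M , u∈f)) ¬avoids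

  #_ : ∀ {p} {P : Pred Edges p} → Decidable P → ℕ
  # P? = length (filter P? (matchings H))

  AvoidsAll : List Vertex → Pred Edges _
  AvoidsAll vs M = All (λ x → Avoids H x M) vs

  avoidsAll? : ∀ vs → Decidable (AvoidsAll vs)
  avoidsAll? vs M = All.all? (λ x → avoids? H x M) vs

  #covering≤length*#avoiding : ∀ vs u (L : List Edge) →
    (∀ {M f} → IsMatching H M → AvoidsAll vs M → f ∈ M → u ∈ edge H f → f ∈ₗ L) →
    # (λ M → avoidsAll? vs M ×-dec ¬? (avoids? H u M)) ≤ length L * # (avoidsAll? (u ∷ vs))
  #covering≤length*#avoiding vs u L L-complete =
    injection⇒length≤length*length (Unique.filter⁺ covering? matchings-unique) removal f image∈ f∈L
      (λ M∈ M′∈ same-removal same-f → trans (sym ([]≔-[]≔-revert (f∈M M∈)))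
        (trans (cong₂ (λ N g → N [ g ]≔ inside) same-removal same-f) ([]≔-[]≔-revert (f∈M M′∈))))
    where
    covering? : Decidable (λ M → AvoidsAll vs M × ¬ Avoids H u M)
    covering? M = avoidsAll? vs M ×-dec ¬? (avoids? H u M)
    module _ {M} (M∈ : M ∈ₗ filter covering? (matchings H)) where
      M! : IsMatching H M
      M! = ∈-matchings⁻ (proj₁ (∈-filter⁻ covering? {xs = matchings H} M∈))
      vs-avoided : AvoidsAll vs M
      vs-avoided = proj₁ (proj₂ (∈-filter⁻ covering? {xs = matchings H} M∈))
      covering-edge : ∃ λ f → f ∈ M × u ∈ edge H f
      covering-edge = ¬Avoids⇒covering-edge (proj₂ (proj₂ (∈-filter⁻ covering? {xs = matchings H} M∈)))
      f : Edge
      f = proj₁ covering-edge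
      f∈M : f ∈ M
      f∈M = proj₁ (proj₂ covering-edge)
      u∈f : u ∈ edge H f
      u∈f = proj₂ (proj₂ covering-edge)
      removal : Edges
      removal = M [ f ]≔ outside
      image∈ : removal ∈ₗ filter (avoidsAll? (u ∷ vs)) (matchings H)
      image∈ = ∈-filter⁺ (avoidsAll? (u ∷ vs)) (∈-matchings⁺ ([]≔outside-isMatching f M!))
        ((λ e e∈ u∈e → M! e f (∈-[]≔outside⁻ e∈) f∈M (λ { refl → f∉[]≔outside e∈ }) u u∈e u∈f)
         ∷ All.map (λ avoids e e∈ → avoids e (∈-[]≔outside⁻ e∈)) vs-avoided)
      f∈L : f ∈ₗ L
      f∈L = L-complete M! vs-avoided f∈M u∈f

  #avoidsAll≤d*#avoidsAll-∷ : ∀ {d} vs u (L : List Edge) →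
    (∀ {M f} → IsMatching H M → AvoidsAll vs M → f ∈ M → u ∈ edge H f → f ∈ₗ L) →
    suc (length L) ≤ d → # (avoidsAll? vs) ≤ d * # (avoidsAll? (u ∷ vs))
  #avoidsAll≤d*#avoidsAll-∷ {d} vs u L L-complete 1+|L|≤d = begin
    # (avoidsAll? vs)
      ≡⟨ length-filter≡∧+∧¬ (avoidsAll? vs) (avoids? H u) (matchings H) ⟩
    # (λ M → avoidsAll? vs M ×-dec avoids? H u M) + # (λ M → avoidsAll? vs M ×-dec ¬? (avoids? H u M))
      ≤⟨ +-mono-≤ (length-filter-mono _ (avoidsAll? (u ∷ vs)) (matchings H)
                     (λ _ (vs-avoided , u-avoided) → u-avoided ∷ vs-avoided))
                  (#covering≤length*#avoiding vs u L L-complete) ⟩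
    suc (length L) * # (avoidsAll? (u ∷ vs))
      ≤⟨ *-monoˡ-≤ _ 1+|L|≤d ⟩
    d * # (avoidsAll? (u ∷ vs)) ∎
    where open ≤-Reasoning

  #avoidsAll≤#containing : ∀ {x e} vs → x ∈ edge H e → (∀ {y} → y ∈ edge H e → y ∈ₗ vs) →
    # (avoidsAll? vs) ≤ # (e ∈?_)
  #avoidsAll≤#containing {x} {e} vs x∈e e⊆vs = ≤-trans
    (injection⇒length≤length*length {zs = e ∷ []} (Unique.filter⁺ (avoidsAll? vs) matchings-unique)
      insertion (λ _ → e) image∈ (λ _ → here refl)
      (λ N∈ N′∈ same-insertion _ → trans (sym ([]≔-[]≔-revert (∉⇒[]=outside (e∉N N∈))))
        (trans (cong (_[ e ]≔ outside) same-insertion) ([]≔-[]≔-revert (∉⇒[]=outside (e∉N N′∈))))))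
    (≤-reflexive (+-identityʳ _))
    where
    module _ {N} (N∈ : N ∈ₗ filter (avoidsAll? vs) (matchings H)) where
      N! : IsMatching H N
      N! = ∈-matchings⁻ (proj₁ (∈-filter⁻ (avoidsAll? vs) {xs = matchings H} N∈))
      e-free : ∀ y → y ∈ edge H e → Avoids H y N
      e-free y y∈e = All.lookup (proj₂ (∈-filter⁻ (avoidsAll? vs) {xs = matchings H} N∈)) (e⊆vs y∈e)
      e∉N : e ∉ N
      e∉N e∈N = e-free x x∈e e e∈N x∈e
      insertion : Edges
      insertion = N [ e ]≔ inside
      image∈ : insertion ∈ₗ filter (e ∈?_) (matchings H)
      image∈ = ∈-filter⁺ (e ∈?_)
        (∈-matchings⁺ ([]≔inside-isMatching e N! e-free))
        ([]≔-updates N e)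

  edgesThrough : Vertex → List Edge
  edgesThrough v = filter (λ e → v ∈? edge H e) (allFin (m H))

  edgesThrough_avoiding_ : Vertex → Vertex → List Edge
  edgesThrough w avoiding v = filter (λ f → (w ∈? edge H f) ×-dec ¬? (v ∈? edge H f)) (allFin (m H))

  otherVertices : Edge → Vertex → List Vertex
  otherVertices e v = filter (λ x → ¬? (x ≟ v)) (filter (_∈? edge H e) (allFin (n H)))

  otherVertices⊆edge : ∀ e v → All (_∈ edge H e) (otherVertices e v)
  otherVertices⊆edge e v = All.tabulate λ x∈ →
    proj₂ (∈-filter⁻ (_∈? edge H e) {xs = allFin (n H)} (proj₁ (∈-filter⁻ (λ x → ¬? (x ≟ v)) x∈)))

  edge⊆otherVertices++[v] : ∀ {e v x} → x ∈ edge H e → x ∈ₗ otherVertices e v ++ v ∷ []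
  edge⊆otherVertices++[v] {e} {v} {x} x∈e with x ≟ v
  ... | yes refl = ∈-++⁺ʳ (otherVertices e v) (here refl)
  ... | no x≢v   = ∈-++⁺ˡ (∈-filter⁺ (λ x → ¬? (x ≟ v)) (∈-filter⁺ (_∈? edge H e) (∈-allFin x) x∈e) x≢v)

  length-otherVertices : ∀ {K e v} → v ∈ edge H e → ∣ edge H e ∣ ≡ suc K → length (otherVertices e v) ≤ K
  length-otherVertices {K} {e} {v} v∈e |e|≡1+K = ≤-pred (subst (length (otherVertices e v) <_)
    (trans (length-members (edge H e)) |e|≡1+K)
    (filter-notAll (λ x → ¬? (x ≟ v)) _
      (Any.map (λ { refl v≢v → v≢v refl }) (∈-filter⁺ (_∈? edge H e) (∈-allFin v) v∈e))))

  containsSome? : (es : List Edge) → Decidable (λ M → Any (_∈ M) es)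
  containsSome? es M = Any.any? (_∈? M) es

  -- Two distinct edges through v never lie in a common matching.
  #containing+#containsSome≤#containsSome-∷ : ∀ {v : Vertex} {e es} → All (λ f → e ≢ f) es →
    v ∈ edge H e → All (λ f → v ∈ edge H f) es →
    # (e ∈?_) + # (containsSome? es) ≤ # (containsSome? (e ∷ es))
  #containing+#containsSome≤#containsSome-∷ {v} {e} {es} e∉es v∈e v∈es = begin
    # (e ∈?_) + # (containsSome? es)
      ≤⟨ +-mono-≤ (length-filter-mono (e ∈?_) (λ M → containsSome? (e ∷ es) M ×-dec (e ∈? M)) (matchings H)
                     (λ _ e∈M → here e∈M , e∈M))
                  (length-filter-mono (containsSome? es) (λ M → containsSome? (e ∷ es) M ×-dec ¬? (e ∈? M)) (matchings H)
                     e-excluded) ⟩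
    # (λ M → containsSome? (e ∷ es) M ×-dec (e ∈? M)) + # (λ M → containsSome? (e ∷ es) M ×-dec ¬? (e ∈? M))
      ≡⟨ length-filter≡∧+∧¬ (containsSome? (e ∷ es)) (λ M → e ∈? M) (matchings H) ⟨
    # (containsSome? (e ∷ es)) ∎
    where
    open ≤-Reasoning
    e-excluded : ∀ {M} → M ∈ₗ matchings H → Any (_∈ M) es → Any (_∈ M) (e ∷ es) × e ∉ M
    e-excluded M∈ some with find some
    ... | f , f∈es , f∈M = there some ,
      λ e∈M → ∈-matchings⁻ M∈ e f e∈M f∈M (All.lookup e∉es f∈es) v v∈e (All.lookup v∈es f∈es)

  #avoiding #covering : Vertex → ℕ
  #avoiding v = # (avoids? H v)
  #covering v = # (λ M → ¬? (avoids? H v M))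

  #avoiding≡#avoidsAll-[v] : ∀ v → #avoiding v ≡ # (avoidsAll? (v ∷ []))
  #avoiding≡#avoidsAll-[v] v = cong length (filter-≐ (avoids? H v) (avoidsAll? (v ∷ [])) ((_∷ []) , All.head) (matchings H))

  1≤#avoiding : ∀ v → 1 ≤ #avoiding v
  1≤#avoiding v =
    ∈⇒1≤length (∈-filter⁺ (avoids? H v) (∈-matchings⁺ ∅-isMatching) (λ e e∈∅ → contradiction e∈∅ ∉⊥))

  probAvoid≡#avoiding/[#avoiding+#covering] : ∀ v → probAvoid H v ≡ #avoiding v ÷ℕ (#avoiding v + #covering v)
  probAvoid≡#avoiding/[#avoiding+#covering] v = cong (#avoiding v ÷ℕ_) (length≡filter+filter-¬ (avoids? H v) (matchings H))

  module _ {d} (regular : IsRegular d H) where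

    1+length-edgesThrough-avoiding≤d : ∀ {e v w} → v ∈ edge H e → w ∈ edge H e →
      suc (length (edgesThrough w avoiding v)) ≤ d
    1+length-edgesThrough-avoiding≤d {e} {v} {w} v∈e w∈e = begin
      1 + length (edgesThrough w avoiding v)
        ≤⟨ +-monoˡ-≤ _ (∈⇒1≤length
             (∈-filter⁺ (λ f → (w ∈? edge H f) ×-dec (v ∈? edge H f)) (∈-allFin e) (w∈e , v∈e))) ⟩
      length (filter (λ f → (w ∈? edge H f) ×-dec (v ∈? edge H f)) (allFin (m H))) + length (edgesThrough w avoiding v)
        ≡⟨ length-filter≡∧+∧¬ (λ f → w ∈? edge H f) (λ f → v ∈? edge H f) (allFin (m H)) ⟨
      degree H w
        ≡⟨ regular w ⟩
      d ∎
      where open ≤-Reasoning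

    -- Once v is avoided, every further vertex of an edge through v can be covered by at most d − 1 edges.
    #avoidsAll≤d^length*#avoidsAll-++ : ∀ {e v} → v ∈ edge H e → ∀ ws vs → v ∈ₗ vs → All (_∈ edge H e) ws →
      # (avoidsAll? vs) ≤ d ^ length ws * # (avoidsAll? (ws ++ vs))
    #avoidsAll≤d^length*#avoidsAll-++ v∈e [] vs v∈vs [] = ≤-reflexive (sym (+-identityʳ _))
    #avoidsAll≤d^length*#avoidsAll-++ {e} {v} v∈e (w ∷ ws) vs v∈vs (w∈e ∷ ws⊆e) = begin
      # (avoidsAll? vs)
        ≤⟨ #avoidsAll≤d^length*#avoidsAll-++ v∈e ws vs v∈vs ws⊆e ⟩
      d ^ length ws * # (avoidsAll? (ws ++ vs))
        ≤⟨ *-monoʳ-≤ (d ^ length ws) (#avoidsAll≤d*#avoidsAll-∷ (ws ++ vs) w (edgesThrough w avoiding v)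
             through-w-avoiding-v (1+length-edgesThrough-avoiding≤d v∈e w∈e)) ⟩
      d ^ length ws * (d * # (avoidsAll? (w ∷ ws ++ vs)))
        ≡⟨ *-assoc (d ^ length ws) d _ ⟨
      d ^ length ws * d * # (avoidsAll? (w ∷ ws ++ vs))
        ≡⟨ cong (_* # (avoidsAll? (w ∷ ws ++ vs))) (*-comm (d ^ length ws) d) ⟩
      d ^ length (w ∷ ws) * # (avoidsAll? ((w ∷ ws) ++ vs)) ∎
      where
      open ≤-Reasoning
      through-w-avoiding-v : ∀ {M f} → IsMatching H M → AvoidsAll (ws ++ vs) M → f ∈ M → w ∈ edge H f →
        f ∈ₗ edgesThrough w avoiding v
      through-w-avoiding-v _ avoided f∈M w∈f =
        ∈-filter⁺ (λ f → (w ∈? edge H f) ×-dec ¬? (v ∈? edge H f)) (∈-allFin _)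
        (w∈f , All.lookup avoided (∈-++⁺ʳ ws v∈vs) _ f∈M)

    #avoiding≤d^K*#containing : ∀ {K e v} → 1 ≤ d → v ∈ edge H e → ∣ edge H e ∣ ≡ suc K →
      #avoiding v ≤ d ^ K * # (e ∈?_)
    #avoiding≤d^K*#containing {K} {e} {v} 1≤d v∈e |e|≡1+K = begin
      #avoiding v
        ≡⟨ #avoiding≡#avoidsAll-[v] v ⟩
      # (avoidsAll? (v ∷ []))
        ≤⟨ #avoidsAll≤d^length*#avoidsAll-++ v∈e (otherVertices e v) (v ∷ []) (here refl) (otherVertices⊆edge e v) ⟩
      d ^ length (otherVertices e v) * # (avoidsAll? (otherVertices e v ++ v ∷ []))
        ≤⟨ *-mono-≤ (^-monoʳ-≤ d {{>-nonZero 1≤d}} (length-otherVertices v∈e |e|≡1+K))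
                    (#avoidsAll≤#containing (otherVertices e v ++ v ∷ []) v∈e edge⊆otherVertices++[v]) ⟩
      d ^ K * # (e ∈?_) ∎
      where open ≤-Reasoning

    length*#avoiding≤d^K*#containsSome : ∀ {K v} → 1 ≤ d → IsUniform (suc K) H →
      ∀ es → Unique es → All (λ e → v ∈ edge H e) es → length es * #avoiding v ≤ d ^ K * # (containsSome? es)
    length*#avoiding≤d^K*#containsSome 1≤d uniform [] [] [] = z≤n
    length*#avoiding≤d^K*#containsSome {K} {v} 1≤d uniform (e ∷ es) (e∉es ∷ es!) (v∈e ∷ v∈es) = begin
      #avoiding v + length es * #avoiding v
        ≤⟨ +-mono-≤ (#avoiding≤d^K*#containing 1≤d v∈e (uniform e))
                    (length*#avoiding≤d^K*#containsSome 1≤d uniform es es! v∈es) ⟩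
      d ^ K * # (e ∈?_) + d ^ K * # (containsSome? es)
        ≡⟨ *-distribˡ-+ (d ^ K) _ _ ⟨
      d ^ K * (# (e ∈?_) + # (containsSome? es))
        ≤⟨ *-monoʳ-≤ (d ^ K) (#containing+#containsSome≤#containsSome-∷ e∉es v∈e v∈es) ⟩
      d ^ K * # (containsSome? (e ∷ es)) ∎
      where open ≤-Reasoning

    #covering≤d*#avoiding : ∀ v → #covering v ≤ d * #avoiding v
    #covering≤d*#avoiding v = begin
      #covering v
        ≤⟨ length-filter-mono _ (λ M → avoidsAll? [] M ×-dec ¬? (avoids? H v M)) (matchings H) (λ _ → [] ,_) ⟩
      # (λ M → avoidsAll? [] M ×-dec ¬? (avoids? H v M))
        ≤⟨ #covering≤length*#avoiding [] v (edgesThrough v)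
             (λ _ _ _ v∈f → ∈-filter⁺ (λ f → v ∈? edge H f) (∈-allFin _) v∈f) ⟩
      length (edgesThrough v) * # (avoidsAll? (v ∷ []))
        ≡⟨ cong₂ _*_ (regular v) (sym (#avoiding≡#avoidsAll-[v] v)) ⟩
      d * #avoiding v ∎
      where open ≤-Reasoning

    #avoiding≤d^K*#covering : ∀ {K} → 1 ≤ d → IsUniform (suc (suc K)) H → ∀ v → #avoiding v ≤ d ^ K * #covering v
    #avoiding≤d^K*#covering {K} 1≤d uniform v = *-cancelˡ-≤ d {{>-nonZero 1≤d}} (begin
      d * #avoiding v
        ≡⟨ cong (_* #avoiding v) (regular v) ⟨
      length (edgesThrough v) * #avoiding v
        ≤⟨ length*#avoiding≤d^K*#containsSome 1≤d uniform (edgesThrough v)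
             (Unique.filter⁺ (λ f → v ∈? edge H f) (Unique.allFin⁺ (m H)))
             (All.tabulate (proj₂ ∘ ∈-filter⁻ (λ f → v ∈? edge H f) {xs = allFin (m H)})) ⟩
      d ^ suc K * # (containsSome? (edgesThrough v))
        ≤⟨ *-monoʳ-≤ (d ^ suc K) (length-filter-mono (containsSome? (edgesThrough v)) (λ M → ¬? (avoids? H v M))
             (matchings H) containsSome⇒covering) ⟩
      d ^ suc K * #covering v
        ≡⟨ *-assoc d (d ^ K) _ ⟩
      d * (d ^ K * #covering v) ∎)
      where
      open ≤-Reasoning
      containsSome⇒covering : ∀ {M} → M ∈ₗ matchings H → Any (_∈ M) (edgesThrough v) → ¬ Avoids H v M
      containsSome⇒covering _ some avoided with find some
      ... | e , e∈ , e∈M = avoided e e∈M (proj₂ (∈-filter⁻ (λ f → v ∈? edge H f) {xs = allFin (m H)} e∈))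

module Ratios where

  open import Data.Nat as ℕ using (ℕ; zero; suc; s≤s)
  import Data.Nat.Properties as ℕ
  open import Data.Integer as ℤ using (+_; -[1+_])
  import Data.Integer.Properties as ℤ
  open import Data.Rational as ℚ using (ℚ; mkℚ; 0ℚ; 1ℚ; _-_; _*_; _≤_; _<_; toℚᵘ; ↧ₙ_)
  open import Data.Rational.Properties
    using (toℚᵘ-fromℚᵘ; toℚᵘ-cancel-≤; toℚᵘ-cancel-<; toℚᵘ-homo-+; toℚᵘ-homo-*; toℚᵘ-homo‿-)
  open import Data.Rational.Unnormalised as ℚᵘ using (ℚᵘ; mkℚᵘ; *≤*; *<*; _≃_)
  import Data.Rational.Unnormalised.Properties as ℚᵘ
  import Data.Integer.Tactic.RingSolver as ℤ-Solver
  import Data.Nat.Tactic.RingSolver as ℕ-Solver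
  open import Relation.Binary.PropositionalEquality

  toℚᵘ-÷ℕ : ∀ a b → toℚᵘ (a ÷ℕ suc b) ≃ mkℚᵘ (+ a) b
  toℚᵘ-÷ℕ a b = toℚᵘ-fromℚᵘ (mkℚᵘ (+ a) b)

  toℚᵘ-homo-- : ∀ p q → toℚᵘ (p - q) ≃ toℚᵘ p ℚᵘ.- toℚᵘ q
  toℚᵘ-homo-- p q = ℚᵘ.≃-trans (toℚᵘ-homo-+ p (ℚ.- q)) (ℚᵘ.+-congʳ (toℚᵘ p) (toℚᵘ-homo‿- q))

  ÷ℕ-mono-≤ : ∀ {a b c e} → a ℕ.* suc e ℕ.≤ c ℕ.* suc b → a ÷ℕ suc b ≤ c ÷ℕ suc e
  ÷ℕ-mono-≤ {a} {b} {c} {e} ae≤cb = toℚᵘ-cancel-≤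
    (ℚᵘ.≤-respˡ-≃ (ℚᵘ.≃-sym (toℚᵘ-÷ℕ a b)) (ℚᵘ.≤-respʳ-≃ (ℚᵘ.≃-sym (toℚᵘ-÷ℕ c e))
      (*≤* (subst₂ ℤ._≤_ (ℤ.pos-* a (suc e)) (ℤ.pos-* c (suc b)) (ℤ.+≤+ ae≤cb)))))

  1/[d+1]≤a/[a+c] : ∀ d {a c} → 1 ℕ.≤ a → c ℕ.≤ d ℕ.* a → 1 ÷ℕ suc d ≤ a ÷ℕ (a ℕ.+ c)
  1/[d+1]≤a/[a+c] d {a@(suc a′)} {c} _ c≤da = ÷ℕ-mono-≤ {1} {d} {a} {a′ ℕ.+ c} (begin
    1 ℕ.* (a ℕ.+ c) ≡⟨ ℕ.*-identityˡ (a ℕ.+ c) ⟩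
    a ℕ.+ c         ≤⟨ ℕ.+-monoʳ-≤ a c≤da ⟩
    a ℕ.+ d ℕ.* a   ≡⟨ ℕ.*-comm (suc d) a ⟩
    a ℕ.* suc d     ∎)
    where open ℕ.≤-Reasoning

  a/[a+c]≤D/[D+1] : ∀ D {a c} → 1 ℕ.≤ a → a ℕ.≤ D ℕ.* c → a ÷ℕ (a ℕ.+ c) ≤ D ÷ℕ suc D
  a/[a+c]≤D/[D+1] D {a@(suc a′)} {c} _ a≤Dc = ÷ℕ-mono-≤ {a} {a′ ℕ.+ c} {D} {D} (begin
    a ℕ.* suc D             ≡⟨ ℕ.*-comm a (suc D) ⟩
    a ℕ.+ D ℕ.* a           ≤⟨ ℕ.+-monoˡ-≤ (D ℕ.* a) a≤Dc ⟩
    D ℕ.* c ℕ.+ D ℕ.* a     ≡⟨ ℕ.+-comm (D ℕ.* c) (D ℕ.* a) ⟩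
    D ℕ.* a ℕ.+ D ℕ.* c     ≡⟨ ℕ.*-distribˡ-+ D a c ⟨
    D ℕ.* (a ℕ.+ c)         ∎)
    where open ℕ.≤-Reasoning

  -- mkℚᵘ n d′ stands for n/(d′+1), so this is 1 − (1 − p/q)·(1/D) with q = q′+1 and D = D′+1.
  1-[1-p/q]/D : ℕ → ℕ → ℕ → ℚᵘ
  1-[1-p/q]/D p q′ D′ = ℚᵘ.1ℚᵘ ℚᵘ.- (ℚᵘ.1ℚᵘ ℚᵘ.- mkℚᵘ (+ p) q′) ℚᵘ.* mkℚᵘ (+ 1) D′

  private
    1*q*[1+D′]≡q+q*D′ : ∀ q D′ → 1 ℕ.* q ℕ.* suc D′ ≡ q ℕ.+ q ℕ.* D′
    1*q*[1+D′]≡q+q*D′ = ℕ-Solver.solve-∀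

    1*[q+x]-[1*q-p]≡x+p : ∀ p q x →
      + 1 ℤ.* (q ℤ.+ x) ℤ.+ ℤ.- ((+ 1 ℤ.* q ℤ.+ ℤ.- p ℤ.* + 1) ℤ.* + 1) ℤ.* + 1 ≡ x ℤ.+ p
    1*[q+x]-[1*q-p]≡x+p = ℤ-Solver.solve-∀

    1*[1*q*D]≡q*D : ∀ q D → 1 ℕ.* (1 ℕ.* q ℕ.* D) ≡ q ℕ.* D
    1*[1*q*D]≡q*D = ℕ-Solver.solve-∀

    D*[q*D]+p*[D+1]≡[q*D′+p]*[D+1]+q : ∀ q D′ p →
      suc D′ ℕ.* (q ℕ.* suc D′) ℕ.+ p ℕ.* suc (suc D′) ≡ (q ℕ.* D′ ℕ.+ p) ℕ.* suc (suc D′) ℕ.+ q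
    D*[q*D]+p*[D+1]≡[q*D′+p]*[D+1]+q = ℕ-Solver.solve-∀

  ↥-1-[1-p/q]/D : ∀ p q′ D′ → ℚᵘ.↥ (1-[1-p/q]/D p q′ D′) ≡ + (suc q′ ℕ.* D′ ℕ.+ p)
  ↥-1-[1-p/q]/D p q′ D′ = begin
    + 1 ℤ.* + (1 ℕ.* q ℕ.* suc D′) ℤ.+ ℤ.- ((+ 1 ℤ.* + q ℤ.+ ℤ.- + p ℤ.* + 1) ℤ.* + 1) ℤ.* + 1
      ≡⟨ cong (λ x → + 1 ℤ.* + x ℤ.+ ℤ.- ((+ 1 ℤ.* + q ℤ.+ ℤ.- + p ℤ.* + 1) ℤ.* + 1) ℤ.* + 1)
              (1*q*[1+D′]≡q+q*D′ q D′) ⟩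
    + 1 ℤ.* (+ q ℤ.+ + (q ℕ.* D′)) ℤ.+ ℤ.- ((+ 1 ℤ.* + q ℤ.+ ℤ.- + p ℤ.* + 1) ℤ.* + 1) ℤ.* + 1
      ≡⟨ 1*[q+x]-[1*q-p]≡x+p (+ p) (+ q) (+ (q ℕ.* D′)) ⟩
    + (q ℕ.* D′ ℕ.+ p) ∎
    where
    open ≡-Reasoning
    q : ℕ
    q = suc q′

  ↧-1-[1-p/q]/D : ∀ p q′ D′ → ℚᵘ.↧ₙ (1-[1-p/q]/D p q′ D′) ≡ suc q′ ℕ.* suc D′
  ↧-1-[1-p/q]/D p q′ D′ = 1*[1*q*D]≡q*D (suc q′) (suc D′)

  -- For ε = p/q in lowest terms, q ≤ D gives p·(D+1) > q, which is exactly the cross-multiplied inequality.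
  D/[D+1]<1-[1-ε]/D : ∀ D (ε : ℚ) → 0ℚ < ε → ↧ₙ ε ℕ.≤ D → D ÷ℕ suc D < 1ℚ - (1ℚ - ε) * (1 ÷ℕ D)
  D/[D+1]<1-[1-ε]/D D@(suc D′) ε@(mkℚ (+ p@(suc _)) q′ _) _ q≤D = toℚᵘ-cancel-<
    (ℚᵘ.<-respˡ-≃ (ℚᵘ.≃-sym (toℚᵘ-÷ℕ D D)) (ℚᵘ.<-respʳ-≃ (ℚᵘ.≃-sym toℚᵘ-bound) (*<* cross)))
    where
    q : ℕ
    q = suc q′
    r : ℚᵘ
    r = 1-[1-p/q]/D p q′ D′
    toℚᵘ-bound : toℚᵘ (1ℚ - (1ℚ - ε) * (1 ÷ℕ D)) ≃ r
    toℚᵘ-bound = ℚᵘ.≃-trans (toℚᵘ-homo-- 1ℚ ((1ℚ - ε) * (1 ÷ℕ D))) (ℚᵘ.+-congʳ ℚᵘ.1ℚᵘ (ℚᵘ.-‿cong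
      (ℚᵘ.≃-trans (toℚᵘ-homo-* (1ℚ - ε) (1 ÷ℕ D)) (ℚᵘ.*-cong (toℚᵘ-homo-- 1ℚ ε) (toℚᵘ-÷ℕ 1 D′)))))
    cross-ℕ : D ℕ.* (q ℕ.* D) ℕ.< (q ℕ.* D′ ℕ.+ p) ℕ.* suc D
    cross-ℕ = ℕ.+-cancelʳ-< _ _ _
      (subst (D ℕ.* (q ℕ.* D) ℕ.+ q ℕ.<_) (D*[q*D]+p*[D+1]≡[q*D′+p]*[D+1]+q q D′ p)
        (ℕ.+-monoʳ-< (D ℕ.* (q ℕ.* D)) (ℕ.≤-trans (s≤s q≤D) (ℕ.m≤n*m (suc D) p))))
    cross : + D ℤ.* ℚᵘ.↧ r ℤ.< ℚᵘ.↥ r ℤ.* + suc D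
    cross = subst₂ ℤ._<_
      (trans (ℤ.pos-* D (q ℕ.* D)) (cong (λ x → + D ℤ.* + x) (sym (↧-1-[1-p/q]/D p q′ D′))))
      (trans (ℤ.pos-* (q ℕ.* D′ ℕ.+ p) (suc D)) (cong (ℤ._* + suc D) (sym (↥-1-[1-p/q]/D p q′ D′))))
      (ℤ.+<+ cross-ℕ)
  D/[D+1]<1-[1-ε]/D zero (mkℚ _ _ _) _ ()
  D/[D+1]<1-[1-ε]/D (suc _) (mkℚ (+ zero) _ _) (ℚ.*<* (ℤ.+<+ ())) _
  D/[D+1]<1-[1-ε]/D (suc _) (mkℚ -[1+ _ ] _ _) (ℚ.*<* ()) _

open import Data.Nat using (ℕ; suc; _>_; _≥_; _^_; _∸_)
open import Data.Rational using (ℚ; 0ℚ; 1ℚ; _-_; _*_; _≤_; _<_)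
open import Data.Fin using (Fin)
open import Data.Product using (Σ; _×_)

open import Data.Nat using (z≤n; s≤s; >-nonZero)
open import Data.Nat.Properties using (≤-trans; m≤m*n; m^n>0)
open import Data.Rational using (↧ₙ_)
open import Data.Rational.Properties using (≤-<-trans)
open import Data.Product using (_,_)
open MatchingCounts
open Ratios

theorem1p5 : (k : ℕ) → k > 2 → (ε : ℚ) → 0ℚ < ε →
    Σ ℕ λ d₀ → d₀ > 0 ×
      ((d : ℕ) → d ≥ d₀ → (H : Hypergraph) → IsUniform k H → IsLinear H → IsRegular d H →
        (v : Fin (n H)) →
          (1 ÷ℕ suc d ≤ probAvoid H v) × (probAvoid H v < 1ℚ - (1ℚ - ε) * (1 ÷ℕ (d ^ (k ∸ 2)))))
theorem1p5 (suc (suc (suc K))) (s≤s (s≤s (s≤s _))) ε 0<ε = ↧ₙ ε , s≤s z≤n , bounds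
  where
  bounds : (d : ℕ) → d ≥ ↧ₙ ε → (H : Hypergraph) → IsUniform (suc (suc (suc K))) H → IsLinear H →
    IsRegular d H → (v : Fin (n H)) →
    (1 ÷ℕ suc d ≤ probAvoid H v) × (probAvoid H v < 1ℚ - (1ℚ - ε) * (1 ÷ℕ (d ^ suc K)))
  bounds d@(suc _) d≥d₀ H uniform _ regular v rewrite probAvoid≡#avoiding/[#avoiding+#covering] H v =
      1/[d+1]≤a/[a+c] d (1≤#avoiding H v) (#covering≤d*#avoiding H regular v)
    , ≤-<-trans
        (a/[a+c]≤D/[D+1] (d ^ suc K) (1≤#avoiding H v) (#avoiding≤d^K*#covering H regular (s≤s z≤n) uniform v))
        (D/[D+1]<1-[1-ε]/D (d ^ suc K) ε 0<ε (≤-trans d≥d₀ (m≤m*n d (d ^ K) {{>-nonZero (m^n>0 d K)}})))
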